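{- Let $a,b$ be nonzero real numbers and let $(M_{p_n})_{n\ge 0}$ be the sequence of bi-periodic Padovan matrices (defined in the context). Then for every integer $n\ge 0$, $$M_{p_n}\cdot M_{p_{n+1}} = M_{p_{n+1}}\cdot M_{p_n}.$$
   Context: For real numbers $a,b$, the sequence $(M_{p_n})_{n\ge0}$ of $3\times 3$ real matrices (bi-periodic Padovan matrices) is defined by $$M_{p_0}=I_3,\quad M_{p_1}=\begin{pmatrix}0&1&0\\0&0&1\\1&a&0\end{pmatrix},\quad M_{p_2}=\begin{pmatrix}0&0&1\\1&a&0\\0&1&a\end{pmatrix},$$ and for $n\ge 3$: $M_{p_n}=aM_{p_{n-2}}+M_{p_{n-3}}$ if $n$ is even, and $M_{p_n}=bM_{p_{n-2}}+M_{p_{n-3}}$ if $n$ is odd. -}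

module Defs where

open import Level using (Level)
open import Data.Nat using (ℕ; zero; suc)
open import Data.Bool using (Bool; true; false; if_then_else_; not)
open import Data.Fin using (Fin; zero; suc)
open import Algebra.Bundles using (CommutativeRing)

isEven : ℕ → Bool
isEven zero    = true
isEven (suc n) = not (isEven n)

module Padovan {c ℓ : Level} (R : CommutativeRing c ℓ) where
  open CommutativeRing R hiding (zero)

  Mat : Set c
  Mat = Fin 3 → Fin 3 → Carrier

  _⊗_ : Mat → Mat → Mat
  (A ⊗ B) i j = (A i zero * B zero j) + (A i (suc zero) * B (suc zero) j)
                + (A i (suc (suc zero)) * B (suc (suc zero)) j)

  _⊕_ : Mat → Mat → Mat
  (A ⊕ B) i j = A i j + B i j

  _·_ : Carrier → Mat → Mat
  (s · A) i j = s * A i j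

  _≋_ : Mat → Mat → Set ℓ
  A ≋ B = ∀ i j → A i j ≈ B i j

  I₃ : Mat
  I₃ zero          zero          = 1#
  I₃ (suc zero)    (suc zero)    = 1#
  I₃ (suc (suc zero)) (suc (suc zero)) = 1#
  I₃ _             _             = 0#

  module _ (a b : Carrier) where
    Mp₁ : Mat
    Mp₁ zero             (suc zero)       = 1#
    Mp₁ (suc zero)       (suc (suc zero)) = 1#
    Mp₁ (suc (suc zero)) zero             = 1#
    Mp₁ (suc (suc zero)) (suc zero)       = a
    Mp₁ _                _                = 0#

    Mp₂ : Mat
    Mp₂ zero             (suc (suc zero)) = 1#
    Mp₂ (suc zero)       zero             = 1#
    Mp₂ (suc zero)       (suc zero)       = a
    Mp₂ (suc (suc zero)) (suc zero)       = 1#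
    Mp₂ (suc (suc zero)) (suc (suc zero)) = a
    Mp₂ _                _                = 0#

    coeff : ℕ → Carrier
    coeff n = if isEven n then a else b

    Mp : ℕ → Mat
    Mp zero                = I₃
    Mp (suc zero)          = Mp₁
    Mp (suc (suc zero))    = Mp₂
    Mp (suc (suc (suc n))) = (coeff (suc (suc (suc n))) · Mp (suc n)) ⊕ Mp n

{-# OPTIONS --safe #-}
-- Commuting with a fixed matrix is preserved by sums and scalar multiples, hence by the
-- recurrence: a matrix commuting with M_{p_0} = I₃, M_{p_1} and M_{p_2} commutes with every
-- M_{p_n}. As I₃ is central and M_{p_2} = M_{p_1}² commutes with M_{p_1}, applying this twice
-- shows that all the matrices M_{p_n} commute pairwise.
module Submission where

open import Defs
open import Level using (Level)
open import Data.Nat using (ℕ; suc)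
open import Data.Fin using (Fin)
open import Data.Fin.Patterns using (0F; 1F; 2F)
open import Data.Product using (_×_)
open import Relation.Nullary using (¬_)
open import Algebra.Bundles using (CommutativeRing)
import Algebra.Solver.Ring.NaturalCoefficients.Default as NaturalCoefficientsSolver
import Relation.Binary.Reasoning.Setoid as SetoidReasoning

module PadovanCommute {c ℓ : Level} (R : CommutativeRing c ℓ) where
  open CommutativeRing R
  open Padovan R
  open NaturalCoefficientsSolver commutativeSemiring
    using (Polynomial; solve; _:=_; _:+_; _:*_; con)
  open SetoidReasoning setoid

  record Commute (A B : Mat) : Set ℓ where
    field commutes : (A ⊗ B) ≋ (B ⊗ A)

  open Commute public

  commute-refl : ∀ {A} → Commute A A
  commute-refl .commutes i j = refl

  commute-sym : ∀ {A B} → Commute A B → Commute B A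
  commute-sym AB .commutes i j = sym (AB .commutes i j)

  ⊗-distribʳ-⊕ : ∀ A B C → ((A ⊕ B) ⊗ C) ≋ ((A ⊗ C) ⊕ (B ⊗ C))
  ⊗-distribʳ-⊕ A B C i j =
    solve 9 (λ a₀ a₁ a₂ b₀ b₁ b₂ c₀ c₁ c₂ →
                (a₀ :+ b₀) :* c₀ :+ (a₁ :+ b₁) :* c₁ :+ (a₂ :+ b₂) :* c₂
             := (a₀ :* c₀ :+ a₁ :* c₁ :+ a₂ :* c₂) :+ (b₀ :* c₀ :+ b₁ :* c₁ :+ b₂ :* c₂))
          refl (A i 0F) (A i 1F) (A i 2F) (B i 0F) (B i 1F) (B i 2F) (C 0F j) (C 1F j) (C 2F j)

  ⊗-distribˡ-⊕ : ∀ C A B → (C ⊗ (A ⊕ B)) ≋ ((C ⊗ A) ⊕ (C ⊗ B))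
  ⊗-distribˡ-⊕ C A B i j =
    solve 9 (λ c₀ c₁ c₂ a₀ a₁ a₂ b₀ b₁ b₂ →
                c₀ :* (a₀ :+ b₀) :+ c₁ :* (a₁ :+ b₁) :+ c₂ :* (a₂ :+ b₂)
             := (c₀ :* a₀ :+ c₁ :* a₁ :+ c₂ :* a₂) :+ (c₀ :* b₀ :+ c₁ :* b₁ :+ c₂ :* b₂))
          refl (C i 0F) (C i 1F) (C i 2F) (A 0F j) (A 1F j) (A 2F j) (B 0F j) (B 1F j) (B 2F j)

  ·-⊗-assoc : ∀ k A B → ((k · A) ⊗ B) ≋ (k · (A ⊗ B))
  ·-⊗-assoc k A B i j =
    solve 7 (λ k a₀ a₁ a₂ b₀ b₁ b₂ →
                k :* a₀ :* b₀ :+ k :* a₁ :* b₁ :+ k :* a₂ :* b₂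
             := k :* (a₀ :* b₀ :+ a₁ :* b₁ :+ a₂ :* b₂))
          refl k (A i 0F) (A i 1F) (A i 2F) (B 0F j) (B 1F j) (B 2F j)

  ⊗-·-comm : ∀ k A B → (A ⊗ (k · B)) ≋ (k · (A ⊗ B))
  ⊗-·-comm k A B i j =
    solve 7 (λ k a₀ a₁ a₂ b₀ b₁ b₂ →
                a₀ :* (k :* b₀) :+ a₁ :* (k :* b₁) :+ a₂ :* (k :* b₂)
             := k :* (a₀ :* b₀ :+ a₁ :* b₁ :+ a₂ :* b₂))
          refl k (A i 0F) (A i 1F) (A i 2F) (B 0F j) (B 1F j) (B 2F j)

  commute-⊕ : ∀ {A B C} → Commute A C → Commute B C → Commute (A ⊕ B) C
  commute-⊕ {A} {B} {C} AC BC .commutes i j = begin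
    ((A ⊕ B) ⊗ C) i j          ≈⟨ ⊗-distribʳ-⊕ A B C i j ⟩
    (A ⊗ C) i j + (B ⊗ C) i j  ≈⟨ +-cong (AC .commutes i j) (BC .commutes i j) ⟩
    (C ⊗ A) i j + (C ⊗ B) i j  ≈⟨ ⊗-distribˡ-⊕ C A B i j ⟨
    (C ⊗ (A ⊕ B)) i j          ∎

  commute-· : ∀ k {A C} → Commute A C → Commute (k · A) C
  commute-· k {A} {C} AC .commutes i j = begin
    ((k · A) ⊗ C) i j  ≈⟨ ·-⊗-assoc k A C i j ⟩
    k * (A ⊗ C) i j    ≈⟨ *-congˡ (AC .commutes i j) ⟩
    k * (C ⊗ A) i j    ≈⟨ ⊗-·-comm k C A i j ⟨
    (C ⊗ (k · A)) i j  ∎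

  ⊗-identityˡ : ∀ A → (I₃ ⊗ A) ≋ A
  ⊗-identityˡ A 0F j = solve 3 (λ x y z → con 1 :* x :+ con 0 :* y :+ con 0 :* z := x)
                         refl (A 0F j) (A 1F j) (A 2F j)
  ⊗-identityˡ A 1F j = solve 3 (λ x y z → con 0 :* x :+ con 1 :* y :+ con 0 :* z := y)
                         refl (A 0F j) (A 1F j) (A 2F j)
  ⊗-identityˡ A 2F j = solve 3 (λ x y z → con 0 :* x :+ con 0 :* y :+ con 1 :* z := z)
                         refl (A 0F j) (A 1F j) (A 2F j)

  ⊗-identityʳ : ∀ A → (A ⊗ I₃) ≋ A
  ⊗-identityʳ A i 0F = solve 3 (λ x y z → x :* con 1 :+ y :* con 0 :+ z :* con 0 := x)
                         refl (A i 0F) (A i 1F) (A i 2F)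
  ⊗-identityʳ A i 1F = solve 3 (λ x y z → x :* con 0 :+ y :* con 1 :+ z :* con 0 := y)
                         refl (A i 0F) (A i 1F) (A i 2F)
  ⊗-identityʳ A i 2F = solve 3 (λ x y z → x :* con 0 :+ y :* con 0 :+ z :* con 1 := z)
                         refl (A i 0F) (A i 1F) (A i 2F)

  I₃-commute : ∀ {A} → Commute I₃ A
  I₃-commute {A} .commutes i j = trans (⊗-identityˡ A i j) (sym (⊗-identityʳ A i j))

  Mp₁-commute-Mp₂ : ∀ a b → Commute (Mp₁ a b) (Mp₂ a b)
  Mp₁-commute-Mp₂ a b .commutes = entry
    where
    Matˢ : Set
    Matˢ = Fin 3 → Fin 3 → Polynomial 1

    -- Mp₁ and Mp₂ transcribed as polynomials in a, so that the solver can check their products.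
    Mp₁ˢ Mp₂ˢ : Polynomial 1 → Matˢ
    Mp₁ˢ x 0F 1F = con 1
    Mp₁ˢ x 1F 2F = con 1
    Mp₁ˢ x 2F 0F = con 1
    Mp₁ˢ x 2F 1F = x
    Mp₁ˢ x _  _  = con 0

    Mp₂ˢ x 0F 2F = con 1
    Mp₂ˢ x 1F 0F = con 1
    Mp₂ˢ x 1F 1F = x
    Mp₂ˢ x 2F 1F = con 1
    Mp₂ˢ x 2F 2F = x
    Mp₂ˢ x _  _  = con 0

    _⊗ˢ_ : Matˢ → Matˢ → Matˢ
    (A ⊗ˢ B) i j = A i 0F :* B 0F j :+ A i 1F :* B 1F j :+ A i 2F :* B 2F j

    identity : Fin 3 → Fin 3 → Polynomial 1 → Polynomial 1 × Polynomial 1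
    identity i j x = (Mp₁ˢ x ⊗ˢ Mp₂ˢ x) i j := (Mp₂ˢ x ⊗ˢ Mp₁ˢ x) i j

    entry : (Mp₁ a b ⊗ Mp₂ a b) ≋ (Mp₂ a b ⊗ Mp₁ a b)
    entry 0F 0F = solve 1 (identity 0F 0F) refl a
    entry 0F 1F = solve 1 (identity 0F 1F) refl a
    entry 0F 2F = solve 1 (identity 0F 2F) refl a
    entry 1F 0F = solve 1 (identity 1F 0F) refl a
    entry 1F 1F = solve 1 (identity 1F 1F) refl a
    entry 1F 2F = solve 1 (identity 1F 2F) refl a
    entry 2F 0F = solve 1 (identity 2F 0F) refl a
    entry 2F 1F = solve 1 (identity 2F 1F) refl a
    entry 2F 2F = solve 1 (identity 2F 2F) refl a

  module _ (a b : Carrier) where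

    commute-initial⇒commute-Mp :
      ∀ {B} → Commute (Mp a b 0) B → Commute (Mp a b 1) B → Commute (Mp a b 2) B →
      ∀ n → Commute (Mp a b n) B
    commute-initial⇒commute-Mp {B} M₀B M₁B M₂B = go
      where
      go : ∀ n → Commute (Mp a b n) B
      go 0 = M₀B
      go 1 = M₁B
      go 2 = M₂B
      go (suc (suc (suc n))) = commute-⊕ (commute-· _ (go (suc n))) (go n)

    Mp₁-commute-Mp : ∀ n → Commute (Mp a b 1) (Mp a b n)
    Mp₁-commute-Mp n = commute-sym
      (commute-initial⇒commute-Mp I₃-commute commute-refl (commute-sym (Mp₁-commute-Mp₂ a b)) n)

    Mp₂-commute-Mp : ∀ n → Commute (Mp a b 2) (Mp a b n)
    Mp₂-commute-Mp n = commute-sym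
      (commute-initial⇒commute-Mp I₃-commute (Mp₁-commute-Mp₂ a b) commute-refl n)

    Mp-commute-Mp : ∀ m n → Commute (Mp a b m) (Mp a b n)
    Mp-commute-Mp m n =
      commute-initial⇒commute-Mp I₃-commute (Mp₁-commute-Mp n) (Mp₂-commute-Mp n) m

proposition2p1 : ∀ {c ℓ : Level} (R : CommutativeRing c ℓ) →
    let open CommutativeRing R
        open Padovan R
    in
    (a b : Carrier) → ¬ (a ≈ 0#) → ¬ (b ≈ 0#) →
    (n : ℕ) → (Mp a b n ⊗ Mp a b (suc n)) ≋ (Mp a b (suc n) ⊗ Mp a b n)
proposition2p1 R a b _ _ n = Mp-commute-Mp a b n (suc n) .commutes
  where open PadovanCommute R
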